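{- Let $\ell$ be a prime. The function $f:\mathbb{N}\to\mathbb{Z}_\ell[[T]]$, $f(n)=P_n(T)$, is uniformly continuous when $\mathbb{N}$ is endowed with the $\ell$-adic topology and $\mathbb{Z}_\ell[[T]]$ with the metric $d(Q,R)=\|Q-R\|$ defined below.
   Context: $\mathbb{N}$ is the set of positive integers. For an integer $a\ge0$, $P_a(X)=2-2\,T_a\!\left(1-\frac{X}{2}\right)\in\mathbb{Z}[X]$, where $T_a$ is the Chebyshev polynomial of the first kind ($T_a(\cos\theta)=\cos(a\theta)$). Let $\mathfrak{m}=(\ell,T)$ be the maximal ideal of $\mathbb{Z}_\ell[[T]]$. For $Q\in\mathbb{Z}_\ell[[T]]$, $\|Q\|=\ell^{ -v}$ where $v=\max\{n\ge0: Q\in\mathfrak{m}^n\}$ if $Q\ne0$ (with $\mathfrak{m}^0$ the whole ring), and $\|0\|=0$. -}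

module Defs where

open import Data.Nat using (ℕ; zero; suc; _∸_; _^_; _<_)
open import Data.Integer using (ℤ; +_; _+_; _-_; _*_; -_)
open import Data.Integer.Divisibility using (_∣_)

-- Polynomials in ℤ[X], represented by their coefficient sequence
-- (coefficient of X^i at index i; only finitely many are nonzero for
-- all polynomials built below).
Poly : Set
Poly = ℕ → ℤ

constP : ℤ → Poly
constP c zero    = c
constP c (suc _) = + 0

Xp : Poly
Xp zero          = + 0
Xp (suc zero)    = + 1
Xp (suc (suc _)) = + 0

_+ₚ_ : Poly → Poly → Poly
(p +ₚ q) i = p i + q i

_-ₚ_ : Poly → Poly → Poly
(p -ₚ q) i = p i - q i

_·ₚ_ : ℤ → Poly → Poly
(c ·ₚ p) i = c * p i

mulX : Poly → Poly
mulX p zero    = + 0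
mulX p (suc i) = p i

-- chebQ a = 2 · T_a(1 - X/2) ∈ ℤ[X].
-- From the Chebyshev recurrence T_0 = 1, T_1 = y, T_{a+2} = 2y T_{a+1} - T_a
-- with y = 1 - X/2 we get Q_0 = 2, Q_1 = 2 - X,
-- Q_{a+2} = (2 - X) Q_{a+1} - Q_a.
chebQ : ℕ → Poly
chebQ zero             = constP (+ 2)
chebQ (suc zero)       = constP (+ 2) -ₚ Xp
chebQ (suc (suc a))    =
  (((+ 2) ·ₚ chebQ (suc a)) -ₚ mulX (chebQ (suc a))) -ₚ chebQ a

P : ℕ → Poly
P a = constP (+ 2) -ₚ chebQ a

-- Membership of a polynomial Q ∈ ℤ[X] ⊂ ℤ_ℓ[[T]] in 𝔪^k, 𝔪 = (ℓ, T):
-- a power series Σ aᵢ Tⁱ lies in (ℓ,T)^k iff ℓ^(k-i) ∣ aᵢ for all i < k.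
-- Hence ‖Q‖ ≤ ℓ^(-k)  ⇔  InMPow ℓ k Q.
InMPow : ℕ → ℕ → Poly → Set
InMPow ℓ k Q = ∀ (i : ℕ) → i < k → (+ (ℓ ^ (k ∸ i))) ∣ Q i

-- Q n = 2 - P n solves Q (n + 2) = (2 - X) Q (n + 1) - Q n, and for every solution s of this
-- recurrence the second difference s (n + 2) - 2 s (n + 1) + s n = - X s (n + 1) lies one level
-- deeper in the (ℓ, X)-adic filtration than s. Writing Δ M s n = s (n + M) - s n, induction on a
-- shows that Δ (ℓ ^ a) moves solutions a levels deeper and Δ (ℓ ^ a) ∘ Δ (ℓ ^ a) moves them a + 1
-- levels deeper: Δ (ℓ M) - ℓ Δ M is a sum of shifted integer multiples of Δ M ∘ Δ M. Hence
-- ℓ ^ k ∣ n - m gives P n ≡ P m modulo 𝔪 ^ k, so j = k works.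
module Submission where

open import Defs
open import Data.Nat using (ℕ; _^_; _≤_)
open import Data.Nat.Primality using (Prime)
open import Data.Integer using (+_; _-_)
open import Data.Integer.Divisibility using (_∣_)
open import Data.Product using (∃-syntax)

open import Data.Nat using (zero; suc; _+_; _*_; _∸_; s≤s; z≤n)
open import Data.Nat.Properties
  using (≤-refl; ≤-total; ∸-monoˡ-≤; m≤n+m; +-assoc; +-comm; +-identityʳ;
         ^-distribˡ-+-*; m+[n∸m]≡n)
import Data.Nat.Divisibility as ℕ
import Data.Integer as ℤ
open ℤ using (-_)
open import Data.Integer.Properties using (pos-*; +-inverseʳ; [+m]-[+n]≡m⊖n; ⊖-≥; ∣⊖∣-≤)
import Data.Integer.Divisibility.Signed as Signed
open Signed using (∣ᵤ⇒∣; ∣⇒∣ᵤ; ∣m⇒∣-m; ∣m∣n⇒∣m+n; ∣m∣n⇒∣m-n; ∣n⇒∣m*n; *-monoʳ-∣; ∣-trans)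
open import Data.Integer.Tactic.RingSolver using (solve-∀)
open import Data.Product using (_×_; _,_; proj₁)
open import Data.Sum using (inj₁; inj₂)
open import Function using (_∘_)
open import Relation.Binary.PropositionalEquality
  using (_≡_; _≗_; refl; sym; trans; cong; cong₂; subst; module ≡-Reasoning)

sub-of-steps : ∀ a a′ x x′ b b′ →
  ((+ 2 ℤ.* a - x) - b) - ((+ 2 ℤ.* a′ - x′) - b′) ≡ (+ 2 ℤ.* (a - a′) - (x - x′)) - (b - b′)
sub-of-steps = solve-∀

second-difference : ∀ a x b → (((+ 2 ℤ.* a - x) - b) - a) - (a - b) ≡ - x
second-difference = solve-∀

neg-sub : ∀ a b → - (a - b) ≡ b - a
neg-sub = solve-∀

telescope : ∀ a b c → a - c ≡ (a - b) ℤ.+ (b - c)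
telescope = solve-∀

sub-add-mul : ∀ x l e → x ≡ (x - l ℤ.* e) ℤ.+ l ℤ.* e
sub-add-mul = solve-∀

error-step : ∀ w x y z r →
  (w - x) - (+ 1 ℤ.+ r) ℤ.* (y - x) ≡ ((w - y) - r ℤ.* (z - y)) ℤ.+ r ℤ.* ((z - y) - (y - x))
error-step = solve-∀

const-sub : ∀ c a b → (c - a) - (c - b) ≡ b - a
const-sub = solve-∀

^-monoʳ-∣ : ∀ ℓ {m n} → m ≤ n → ℓ ^ m ℕ.∣ ℓ ^ n
^-monoʳ-∣ ℓ {m} {n} m≤n = subst (ℓ ^ m ℕ.∣_) ℓ^m*ℓ^[n∸m]≡ℓ^n (ℕ.m∣m*n (ℓ ^ (n ∸ m)))
  where
  ℓ^m*ℓ^[n∸m]≡ℓ^n : ℓ ^ m * ℓ ^ (n ∸ m) ≡ ℓ ^ n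
  ℓ^m*ℓ^[n∸m]≡ℓ^n = trans (sym (^-distribˡ-+-* ℓ m (n ∸ m))) (cong (ℓ ^_) (m+[n∸m]≡n m≤n))

suc-∸-≤ : ∀ k i → suc k ∸ i ≤ suc (k ∸ i)
suc-∸-≤ k       zero          = ≤-refl
suc-∸-≤ zero    (suc zero)    = z≤n
suc-∸-≤ zero    (suc (suc i)) = z≤n
suc-∸-≤ (suc k) (suc i)       = suc-∸-≤ k i

mulX-sub : ∀ p q → mulX (p -ₚ q) ≗ mulX p -ₚ mulX q
mulX-sub p q zero    = refl
mulX-sub p q (suc i) = refl

chebStep : Poly → Poly → Poly
chebStep p q = (((+ 2) ·ₚ p) -ₚ mulX p) -ₚ q

chebStep-sub : ∀ p p′ q q′ → chebStep p q -ₚ chebStep p′ q′ ≗ chebStep (p -ₚ p′) (q -ₚ q′)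
chebStep-sub p p′ q q′ i =
  trans (sub-of-steps (p i) (p′ i) (mulX p i) (mulX p′ i) (q i) (q′ i))
        (cong (λ x → (+ 2 ℤ.* (p i - p′ i) - x) - (q i - q′ i)) (sym (mulX-sub p p′ i)))

Seq : Set
Seq = ℕ → Poly

Δ : ℕ → Seq → Seq
Δ M s n = s (n + M) -ₚ s n

Recurrent : Seq → Set
Recurrent s = ∀ n → s (2 + n) ≗ chebStep (s (1 + n)) (s n)

chebQ-recurrent : Recurrent chebQ
chebQ-recurrent n i = refl

Δ-recurrent : ∀ M {s} → Recurrent s → Recurrent (Δ M s)
Δ-recurrent M {s} rec n i =
  trans (cong₂ _-_ (rec (n + M) i) (rec n i))
        (chebStep-sub (s (1 + (n + M))) (s (1 + n)) (s (n + M)) (s n) i)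

module _ (ℓ : ℕ) where

  infix 4 _∈𝔪^_ _⊆𝔪^_

  -- InMPow with signed divisibility; the bound i < k is dropped since for i ≥ k it reads ℓ ^ 0 ∣ p i.
  _∈𝔪^_ : Poly → ℕ → Set
  p ∈𝔪^ k = ∀ i → + (ℓ ^ (k ∸ i)) Signed.∣ p i

  ∈𝔪^⇒InMPow : ∀ {p k} → p ∈𝔪^ k → InMPow ℓ k p
  ∈𝔪^⇒InMPow p∈𝔪^k i _ = ∣⇒∣ᵤ (p∈𝔪^k i)

  ∈𝔪^-resp : ∀ {p q k} → p ≗ q → p ∈𝔪^ k → q ∈𝔪^ k
  ∈𝔪^-resp p≗q p∈𝔪^k i = subst (_ Signed.∣_) (p≗q i) (p∈𝔪^k i)

  ∈𝔪^0 : ∀ p → p ∈𝔪^ 0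
  ∈𝔪^0 p zero    = ∣ᵤ⇒∣ (ℕ.1∣ _)
  ∈𝔪^0 p (suc i) = ∣ᵤ⇒∣ (ℕ.1∣ _)

  ≗0⇒∈𝔪^ : ∀ {p k} → (∀ i → p i ≡ + 0) → p ∈𝔪^ k
  ≗0⇒∈𝔪^ p≗0 i = subst (_ Signed.∣_) (sym (p≗0 i)) (∣ᵤ⇒∣ (_ ℕ.∣0))

  ∈𝔪^-antimono : ∀ {p j k} → j ≤ k → p ∈𝔪^ k → p ∈𝔪^ j
  ∈𝔪^-antimono j≤k p∈𝔪^k i = ∣-trans (∣ᵤ⇒∣ (^-monoʳ-∣ ℓ (∸-monoˡ-≤ i j≤k))) (p∈𝔪^k i)

  ∈𝔪^-add : ∀ {p q k} → p ∈𝔪^ k → q ∈𝔪^ k → (p +ₚ q) ∈𝔪^ k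
  ∈𝔪^-add p∈𝔪^k q∈𝔪^k i = ∣m∣n⇒∣m+n (p∈𝔪^k i) (q∈𝔪^k i)

  ∈𝔪^-sub : ∀ {p q k} → p ∈𝔪^ k → q ∈𝔪^ k → (p -ₚ q) ∈𝔪^ k
  ∈𝔪^-sub p∈𝔪^k q∈𝔪^k i = ∣m∣n⇒∣m-n (p∈𝔪^k i) (q∈𝔪^k i)

  ∈𝔪^-scale : ∀ c {p k} → p ∈𝔪^ k → (c ·ₚ p) ∈𝔪^ k
  ∈𝔪^-scale c p∈𝔪^k i = ∣n⇒∣m*n c (p∈𝔪^k i)

  ∈𝔪^-ℓ· : ∀ {p k} → p ∈𝔪^ k → ((+ ℓ) ·ₚ p) ∈𝔪^ suc k
  ∈𝔪^-ℓ· {p} {k} p∈𝔪^k i =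
    ∣-trans (∣ᵤ⇒∣ (^-monoʳ-∣ ℓ (suc-∸-≤ k i)))
            (subst (Signed._∣ (+ ℓ ℤ.* p i)) (sym (pos-* ℓ (ℓ ^ (k ∸ i))))
                   (*-monoʳ-∣ (+ ℓ) (p∈𝔪^k i)))

  ∈𝔪^-mulX : ∀ {p k} → p ∈𝔪^ k → mulX p ∈𝔪^ suc k
  ∈𝔪^-mulX p∈𝔪^k zero    = ∣ᵤ⇒∣ (_ ℕ.∣0)
  ∈𝔪^-mulX p∈𝔪^k (suc i) = p∈𝔪^k i

  ∈𝔪^-sub-swap : ∀ p q {k} → (p -ₚ q) ∈𝔪^ k → (q -ₚ p) ∈𝔪^ k
  ∈𝔪^-sub-swap p q p-q∈𝔪^k =
    ∈𝔪^-resp (λ i → neg-sub (p i) (q i)) (λ i → ∣m⇒∣-m (p-q∈𝔪^k i))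

  _⊆𝔪^_ : Seq → ℕ → Set
  s ⊆𝔪^ k = ∀ n → s n ∈𝔪^ k

  Raises : ℕ → (Seq → Seq) → Set
  Raises a D = ∀ {k s} → Recurrent s → s ⊆𝔪^ k → D s ⊆𝔪^ (a + k)

  Δ1-raises-0 : Raises 0 (Δ 1)
  Δ1-raises-0 _ s⊆𝔪^k n = ∈𝔪^-sub (s⊆𝔪^k (n + 1)) (s⊆𝔪^k n)

  Δ1²-raises-1 : Raises 1 (Δ 1 ∘ Δ 1)
  Δ1²-raises-1 {k} {s} rec s⊆𝔪^k n =
    ∈𝔪^-resp (λ i → sym (Δ1²≡-X· i)) (λ i → ∣m⇒∣-m (∈𝔪^-mulX (s⊆𝔪^k (1 + n)) i))
    where
    open ≡-Reasoning
    Δ1-suc : ∀ m → Δ 1 s m ≗ s (suc m) -ₚ s m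
    Δ1-suc m i = cong (λ j → s j i - s m i) (+-comm m 1)
    Δ1²≡-X· : ∀ i → Δ 1 (Δ 1 s) n i ≡ - mulX (s (1 + n)) i
    Δ1²≡-X· i = begin
      Δ 1 s (n + 1) i - Δ 1 s n i
        ≡⟨ cong₂ _-_ (trans (cong (λ m → Δ 1 s m i) (+-comm n 1)) (Δ1-suc (suc n) i)) (Δ1-suc n i) ⟩
      (s (2 + n) i - s (1 + n) i) - (s (1 + n) i - s n i)
        ≡⟨ cong (λ x → (x - s (1 + n) i) - (s (1 + n) i - s n i)) (rec n i) ⟩
      (chebStep (s (1 + n)) (s n) i - s (1 + n) i) - (s (1 + n) i - s n i)
        ≡⟨ second-difference (s (1 + n) i) (mulX (s (1 + n)) i) (s n i) ⟩
      - mulX (s (1 + n)) i ∎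

  Δ0≡0 : ∀ s n i → Δ 0 s n i ≡ + 0
  Δ0≡0 s n i = trans (cong (λ m → s m i - s n i) (+-identityʳ n)) (+-inverseʳ (s n i))

  Δ-raises-multiple : ∀ {a M} → Raises a (Δ M) → ∀ t → Raises a (Δ (t * M))
  Δ-raises-multiple _ zero {s = s} _ _ n = ≗0⇒∈𝔪^ (Δ0≡0 s n)
  Δ-raises-multiple {M = M} ΔM↑ (suc t) {s = s} rec s⊆𝔪^k n =
    ∈𝔪^-resp split (∈𝔪^-add (Δ-raises-multiple ΔM↑ t rec s⊆𝔪^k (n + M)) (ΔM↑ rec s⊆𝔪^k n))
    where
    split : Δ (t * M) s (n + M) +ₚ Δ M s n ≗ Δ (suc t * M) s n
    split i = trans (sym (telescope (s (n + M + t * M) i) (s (n + M) i) (s n i)))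
                    (cong (λ m → s m i - s n i) (+-assoc n M (t * M)))

  Δ-raises-ℓ* : ∀ {a M} → Raises a (Δ M) → Raises (suc a) (Δ M ∘ Δ M) →
                Raises (suc a) (Δ (ℓ * M))
  Δ-raises-ℓ* {a} {M} ΔM↑ ΔM²↑ {k} {s} rec s⊆𝔪^k n =
    ∈𝔪^-resp (λ i → sym (sub-add-mul (Δ (ℓ * M) s n i) (+ ℓ) (Δ M s n i)))
             (∈𝔪^-add (error-⊆ ℓ n) (∈𝔪^-ℓ· (ΔM↑ rec s⊆𝔪^k n)))
    where
    error : ℕ → Seq
    error r n = Δ (r * M) s n -ₚ ((+ r) ·ₚ Δ M s n)
    error-suc : ∀ r n → error r (n + M) +ₚ ((+ r) ·ₚ Δ M (Δ M s) n) ≗ error (suc r) n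
    error-suc r n i =
      trans (sym (error-step (s (n + M + r * M) i) (s n i) (s (n + M) i) (s (n + M + M) i) (+ r)))
            (cong (λ m → (s m i - s n i) - (+ suc r) ℤ.* (s (n + M) i - s n i)) (+-assoc n M (r * M)))
    error-⊆ : ∀ r → error r ⊆𝔪^ suc a + k
    error-⊆ zero    n = ≗0⇒∈𝔪^ (λ i → cong (_- (+ 0 ℤ.* Δ M s n i)) (Δ0≡0 s n i))
    error-⊆ (suc r) n =
      ∈𝔪^-resp (error-suc r n)
               (∈𝔪^-add (error-⊆ r (n + M)) (∈𝔪^-scale (+ r) (ΔM²↑ rec s⊆𝔪^k n)))

  Δ²-raises : ∀ {a M} → Raises (suc a) (Δ M) → Raises (suc (suc a)) (Δ M ∘ Δ M)
  Δ²-raises {a} {M} ΔM↑ {k} {s} rec s⊆𝔪^k =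
    ∈𝔪^-antimono (s≤s (m≤n+m (suc (a + k)) a)) ∘ ΔM↑ (Δ-recurrent M {s} rec) (ΔM↑ rec s⊆𝔪^k)

  Δℓ^a-raises : ∀ a → Raises a (Δ (ℓ ^ a)) × Raises (suc a) (Δ (ℓ ^ a) ∘ Δ (ℓ ^ a))
  Δℓ^a-raises zero    = Δ1-raises-0 , Δ1²-raises-1
  Δℓ^a-raises (suc a) = Δℓ^[1+a]↑ , Δ²-raises Δℓ^[1+a]↑
    where
    Δℓ^[1+a]↑ : Raises (suc a) (Δ (ℓ ^ suc a))
    Δℓ^[1+a]↑ = let (Δℓ^a↑ , Δℓ^a²↑) = Δℓ^a-raises a in Δ-raises-ℓ* Δℓ^a↑ Δℓ^a²↑

  chebQ-Δ-multiple-ℓ^k : ∀ k t → Δ (t * ℓ ^ k) chebQ ⊆𝔪^ k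
  chebQ-Δ-multiple-ℓ^k k t =
    subst (Δ (t * ℓ ^ k) chebQ ⊆𝔪^_) (+-identityʳ k)
          (Δ-raises-multiple (proj₁ (Δℓ^a-raises k)) t {s = chebQ} chebQ-recurrent (∈𝔪^0 ∘ chebQ))

  chebQ-congruence-≤ : ∀ {k m n} → m ≤ n → ℓ ^ k ℕ.∣ n ∸ m → (chebQ n -ₚ chebQ m) ∈𝔪^ k
  chebQ-congruence-≤ {k} {m} {n} m≤n (ℕ.divides t n∸m≡t*ℓ^k) =
    subst (λ j → (chebQ j -ₚ chebQ m) ∈𝔪^ k) m+t*ℓ^k≡n (chebQ-Δ-multiple-ℓ^k k t m)
    where
    m+t*ℓ^k≡n : m + t * ℓ ^ k ≡ n
    m+t*ℓ^k≡n = trans (cong (λ d → m + d) (sym n∸m≡t*ℓ^k)) (m+[n∸m]≡n m≤n)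

  chebQ-congruence : ∀ {k} n m → + (ℓ ^ k) ∣ (+ n - + m) → (chebQ n -ₚ chebQ m) ∈𝔪^ k
  chebQ-congruence {k} n m ℓ^k∣n-m with ≤-total m n
  ... | inj₁ m≤n = chebQ-congruence-≤ m≤n
        (subst (ℓ ^ k ℕ.∣_) (cong ℤ.∣_∣ (trans ([+m]-[+n]≡m⊖n n m) (⊖-≥ m≤n))) ℓ^k∣n-m)
  ... | inj₂ n≤m = ∈𝔪^-sub-swap (chebQ m) (chebQ n) (chebQ-congruence-≤ n≤m
        (subst (ℓ ^ k ℕ.∣_) (trans (cong ℤ.∣_∣ ([+m]-[+n]≡m⊖n n m)) (∣⊖∣-≤ n≤m)) ℓ^k∣n-m))

corollary3p1 : ∀ (ℓ : ℕ) → Prime ℓ →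
    ∀ (k : ℕ) → ∃[ j ] (∀ (n m : ℕ) → 1 ≤ n → 1 ≤ m →
      (+ (ℓ ^ j)) ∣ (+ n - + m) → InMPow ℓ k (P n -ₚ P m))
corollary3p1 ℓ _ k = k , λ n m _ _ ℓ^k∣n-m →
  ∈𝔪^⇒InMPow ℓ (∈𝔪^-resp ℓ (λ i → sym (const-sub (constP (+ 2) i) (chebQ n i) (chebQ m i)))
                          (∈𝔪^-sub-swap ℓ (chebQ n) (chebQ m) (chebQ-congruence ℓ n m ℓ^k∣n-m)))
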